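{- Let $\epsilon>0$ and let $n$ be a positive integer. If $G$ is a graph with $N\ge 128\epsilon^{ -3}n$ vertices and $V_1$ is the set of vertices of $G$ of degree at least $\epsilon N/2$, then there are nested vertex subsets $V_1=A_0\supset A_1\supset A_2\supset\cdots$ such that for all $i\ge 0$, $|A_{i+1}|\ge \frac{\epsilon}{8}|A_i|$, and each vertex in $A_i$ has codegree at least $n$ with all but at most $(\epsilon/8)^i|A_i|$ vertices of $A_i$.
   Context: The codegree of a pair of vertices in a graph is the number of their common neighbors (vertices adjacent to both).
   Formalization: The parameter ε ranges over the positive rationals. -}

module Defs where

open import Data.Nat as ℕ using (ℕ; zero; suc; _<ᵇ_)
open import Data.Bool using (Bool; _∧_)
open import Data.Fin using (Fin)
open import Data.Fin.Subset using (Subset; _∩_; ∣_∣)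
open import Data.Vec using (tabulate)
open import Data.Integer using (+_)
open import Data.Rational using (ℚ; _/_; _*_; 1ℚ; _≤_)
open import Data.Rational.Properties using (_≤?_)
open import Relation.Nullary.Decidable using (⌊_⌋)
open import Relation.Binary.PropositionalEquality using (_≡_)

ℕ→ℚ : ℕ → ℚ
ℕ→ℚ n = + n / 1

_^ℚ_ : ℚ → ℕ → ℚ
q ^ℚ zero = 1ℚ
q ^ℚ suc k = q * (q ^ℚ k)

record Graph (N : ℕ) : Set where
  field
    adj   : Fin N → Fin N → Bool
    sym   : ∀ u v → adj u v ≡ adj v u
    irrefl : ∀ v → adj v v ≡ Data.Bool.false
open Graph public

nbhd : ∀ {N} → Graph N → Fin N → Subset N
nbhd G v = tabulate (adj G v)

degree : ∀ {N} → Graph N → Fin N → ℕ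
degree G v = ∣ nbhd G v ∣

codeg : ∀ {N} → Graph N → Fin N → Fin N → ℕ
codeg G u v = ∣ nbhd G u ∩ nbhd G v ∣

highDeg : ∀ {N} → Graph N → ℚ → Subset N
highDeg {N} G ε = tabulate (λ v → ⌊ (ε * ℕ→ℚ N) * (+ 1 / 2) ≤? ℕ→ℚ (degree G v) ⌋)

lowCodeg : ∀ {N} → Graph N → ℕ → Subset N → Fin N → Subset N
lowCodeg G n A v = A ∩ tabulate (λ w → codeg G v w <ᵇ n)

module Submission where

-- Write ε = p / q and D = 8 q, so ε / 8 = p / D; all the combinatorics is done
-- in ℕ with denominators cleared, and translated to ℚ only at the end
-- (Fractions, Scaling).  Given A = A_i, consider for every vertex u the set
-- A ∩ N(u) and delete from it the vertices with too many low-codegree partners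
-- inside it (Cleaning: a Markov bound).  Double counting (GraphCounting) gives
-- Σ_u |A ∩ N(u)| = Σ_{v ∈ A} deg v ≥ |A| ε N / 2, while the low pairs inside
-- the sets A ∩ N(u), counted over all u, are at most n times the low pairs of
-- A, since a low pair has fewer than n common neighbours.  So few vertices are
-- deleted in total (Arithmetic), and the largest cleaned set is A_{i+1}: it has
-- at least (ε/4) |A_i| vertices and satisfies the level-(i+1) condition
-- (Refinement).

module FiniteCounting where

  open import Data.Nat using (ℕ; zero; suc; _+_; _*_; _≤_; z≤n; _≤?_)
  open import Data.Nat.Properties
  open import Data.Bool using (Bool; true; false; _∧_)
  open import Data.Fin using (Fin; zero; suc)
  open import Data.Vec using ([]; _∷_; lookup)
  open import Data.Fin.Subset using (Subset; ∣_∣)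
  open import Data.Product using (∃; _,_)
  open import Function using (_∘_)
  open import Relation.Binary.PropositionalEquality
  open import Relation.Nullary using (yes; no)
  open import Algebra.Properties.Semiring.Sum +-*-semiring public
    using (sum; sum-cong-≗; ∑-distrib-+; ∑-comm; *-distribˡ-sum; *-distribʳ-sum)

  sum-mono : ∀ {N} {f g : Fin N → ℕ} → (∀ i → f i ≤ g i) → sum f ≤ sum g
  sum-mono {zero}  f≤g = z≤n
  sum-mono {suc N} f≤g = +-mono-≤ (f≤g zero) (sum-mono (f≤g ∘ suc))

  sum-affine : ∀ {N} c d (f g h : Fin N → ℕ) → (∀ i → c * f i ≤ c * g i + d * h i) →
               c * sum f ≤ c * sum g + d * sum h
  sum-affine c d f g h pointwise = begin
    c * sum f                                ≡⟨ *-distribˡ-sum c f ⟩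
    sum (λ i → c * f i)                      ≤⟨ sum-mono pointwise ⟩
    sum (λ i → c * g i + d * h i)            ≡⟨ ∑-distrib-+ (λ i → c * g i) (λ i → d * h i) ⟩
    sum (λ i → c * g i) + sum (λ i → d * h i) ≡⟨ sym (cong₂ _+_ (*-distribˡ-sum c g) (*-distribˡ-sum d h)) ⟩
    c * sum g + d * sum h                    ∎
    where open ≤-Reasoning

  sum-≤-* : ∀ {N} (f : Fin N → ℕ) c → (∀ i → f i ≤ c) → sum f ≤ N * c
  sum-≤-* {zero}  f c f≤c = z≤n
  sum-≤-* {suc N} f c f≤c = +-mono-≤ (f≤c zero) (sum-≤-* (f ∘ suc) c (f≤c ∘ suc))

  above-average : ∀ {M} (f : Fin (suc M) → ℕ) → ∃ λ b → sum f ≤ suc M * f b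
  above-average f = let b , max = argmax f in b , sum-≤-* f (f b) max
    where
    argmax : ∀ {M} (f : Fin (suc M) → ℕ) → ∃ λ b → ∀ i → f i ≤ f b
    argmax {zero} f = zero , λ { zero → ≤-refl }
    argmax {suc M} f with argmax (f ∘ suc)
    ... | b , max with f zero ≤? f (suc b)
    ... | yes f0≤fb = suc b , λ { zero → f0≤fb ; (suc i) → max i }
    ... | no  f0≰fb = zero , λ { zero → ≤-refl ; (suc i) → ≤-trans (max i) (<⇒≤ (≰⇒> f0≰fb)) }

  χ : Bool → ℕ
  χ true  = 1
  χ false = 0

  χ-∧ : ∀ a b → χ (a ∧ b) ≡ χ a * χ b
  χ-∧ true  b = sym (+-identityʳ (χ b))
  χ-∧ false b = refl

  ∣∣-sum : ∀ {N} (A : Subset N) → ∣ A ∣ ≡ sum (χ ∘ lookup A)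
  ∣∣-sum []          = refl
  ∣∣-sum (true ∷ A)  = cong suc (∣∣-sum A)
  ∣∣-sum (false ∷ A) = ∣∣-sum A

  ∣∣-by : ∀ {N} (A : Subset N) (f : Fin N → Bool) → (∀ v → lookup A v ≡ f v) →
          ∣ A ∣ ≡ sum (χ ∘ f)
  ∣∣-by A f A≗f = trans (∣∣-sum A) (sum-cong-≗ (cong χ ∘ A≗f))

  sum-over-const : ∀ {N} (A : Subset N) c → sum (λ v → χ (lookup A v) * c) ≡ ∣ A ∣ * c
  sum-over-const A c = trans (sym (*-distribʳ-sum c (χ ∘ lookup A))) (cong (_* c) (sym (∣∣-sum A)))

module GraphCounting where

  open import Defs using (Graph; adj; nbhd; degree; codeg; lowCodeg)
  open import Data.Nat using (ℕ; _*_; _≤_; _<ᵇ_; z≤n)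
  open import Data.Nat.Properties using (*-monoʳ-≤; *-comm; <⇒≤; <ᵇ⇒<; module ≤-Reasoning)
  open import Data.Bool using (Bool; true; false; _∧_; T)
  open import Data.Bool.Properties using (∧-comm)
  open import Data.Fin using (Fin)
  open import Data.Vec using (lookup)
  open import Data.Vec.Properties using (lookup∘tabulate; lookup-zipWith)
  open import Data.Fin.Subset using (Subset; ∣_∣; _∩_; _⊆_)
  open import Data.Fin.Subset.Properties using (p⊆q⇒∣p∣≤∣q∣; x∈p∩q⁺; x∈p∩q⁻)
  open import Data.Product using (_,_)
  open import Function using (_∘_)
  open import Relation.Binary.PropositionalEquality
  open FiniteCounting

  lookup-∩ : ∀ {N} (A B : Subset N) v → lookup (A ∩ B) v ≡ lookup A v ∧ lookup B v
  lookup-∩ A B v = lookup-zipWith _∧_ v A B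

  χ-∧-sum : ∀ {N} x (g : Fin N → Bool) → χ x * sum (χ ∘ g) ≡ sum (λ i → χ (x ∧ g i))
  χ-∧-sum x g = trans (*-distribˡ-sum (χ x) (χ ∘ g)) (sum-cong-≗ (λ i → sym (χ-∧ x (g i))))

  -- Regrouping the conditions "v ∈ A ∩ N(u)", "w ∈ A ∩ N(u)" and
  -- "v, w have low codegree" into "low pair of A" and "u is a common neighbour".
  ∧-shuffle : ∀ a b c d l → (a ∧ c) ∧ ((b ∧ d) ∧ l) ≡ (a ∧ (b ∧ l)) ∧ (c ∧ d)
  ∧-shuffle false b     c     d l     = refl
  ∧-shuffle true  false false d l     = refl
  ∧-shuffle true  true  false d false = refl
  ∧-shuffle true  true  false d true  = refl
  ∧-shuffle true  false true  d l     = refl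
  ∧-shuffle true  true  true  d l     = ∧-comm d l

  module _ {N} (G : Graph N) (n : ℕ) where

    low : Fin N → Fin N → Bool
    low v w = codeg G v w <ᵇ n

    lowCount : Subset N → Fin N → ℕ
    lowCount A v = ∣ lowCodeg G n A v ∣

    lowCount-sum : ∀ A v → lowCount A v ≡ sum (λ w → χ (lookup A w ∧ low v w))
    lowCount-sum A v = ∣∣-by (lowCodeg G n A v) _ λ w →
      trans (lookup-∩ A _ w) (cong (lookup A w ∧_) (lookup∘tabulate (low v) w))

    lowCount-mono : ∀ {A B} v → A ⊆ B → lowCount A v ≤ lowCount B v
    lowCount-mono {A} {B} v A⊆B = p⊆q⇒∣p∣≤∣q∣ λ w∈ →
      let w∈A , w∈L = x∈p∩q⁻ A _ w∈ in x∈p∩q⁺ (A⊆B w∈A , w∈L)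

    degree-sum : ∀ v → degree G v ≡ sum (λ u → χ (adj G v u))
    degree-sum v = ∣∣-by (nbhd G v) _ (lookup∘tabulate (adj G v))

    codeg-sum : ∀ v w → codeg G v w ≡ sum (λ u → χ (adj G v u ∧ adj G w u))
    codeg-sum v w = ∣∣-by (nbhd G v ∩ nbhd G w) _ λ u →
      trans (lookup-∩ (nbhd G v) (nbhd G w) u)
            (cong₂ _∧_ (lookup∘tabulate (adj G v) u) (lookup∘tabulate (adj G w) u))

    lookup-link : ∀ A u v → lookup (A ∩ nbhd G u) v ≡ lookup A v ∧ adj G v u
    lookup-link A u v = trans (lookup-∩ A (nbhd G u) v)
      (cong (lookup A v ∧_) (trans (lookup∘tabulate (adj G u) v) (Graph.sym G u v)))

    handshake : ∀ A → sum (λ u → ∣ A ∩ nbhd G u ∣) ≡ sum (λ v → χ (lookup A v) * degree G v)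
    handshake A = begin
      sum (λ u → ∣ A ∩ nbhd G u ∣)                         ≡⟨ sum-cong-≗ (λ u → ∣∣-by (A ∩ nbhd G u) _ (lookup-link A u)) ⟩
      sum (λ u → sum (λ v → χ (lookup A v ∧ adj G v u)))  ≡⟨ ∑-comm (λ u v → χ (lookup A v ∧ adj G v u)) ⟩
      sum (λ v → sum (λ u → χ (lookup A v ∧ adj G v u)))  ≡⟨ sum-cong-≗ (λ v → sym (χ-∧-sum (lookup A v) (adj G v))) ⟩
      sum (λ v → χ (lookup A v) * sum (λ u → χ (adj G v u))) ≡⟨ sum-cong-≗ (λ v → cong (χ (lookup A v) *_) (sym (degree-sum v))) ⟩
      sum (λ v → χ (lookup A v) * degree G v)              ∎
      where open ≡-Reasoning

    lowPair : Subset N → Fin N → Fin N → Bool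
    lowPair A v w = lookup A v ∧ (lookup A w ∧ low v w)

    pairs-count : ∀ A v → χ (lookup A v) * lowCount A v ≡ sum (λ w → χ (lowPair A v w))
    pairs-count A v = trans (cong (χ (lookup A v) *_) (lowCount-sum A v)) (χ-∧-sum (lookup A v) (λ w → lookup A w ∧ low v w))

    link-count : ∀ A u v → χ (lookup (A ∩ nbhd G u) v) * lowCount (A ∩ nbhd G u) v
                         ≡ sum (λ w → χ (lowPair A v w ∧ (adj G v u ∧ adj G w u)))
    link-count A u v = trans (pairs-count (A ∩ nbhd G u) v) (sum-cong-≗ λ w →
      cong χ (trans (cong₂ (λ x y → x ∧ (y ∧ low v w)) (lookup-link A u v) (lookup-link A u w))
                    (∧-shuffle (lookup A v) (lookup A w) (adj G v u) (adj G w u) (low v w))))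

    lowPair-codeg : ∀ A v w → χ (lowPair A v w) * codeg G v w ≤ χ (lowPair A v w) * n
    lowPair-codeg A v w with lookup A v | lookup A w | low v w in lowvw
    ... | false | _     | _    = z≤n
    ... | true  | false | _    = z≤n
    ... | true  | true  | false = z≤n
    ... | true  | true  | true = *-monoʳ-≤ 1 (<⇒≤ (<ᵇ⇒< (codeg G v w) n (subst T (sym lowvw) _)))

    codegree-count : ∀ A →
      sum (λ u → sum (λ v → χ (lookup (A ∩ nbhd G u) v) * lowCount (A ∩ nbhd G u) v))
        ≤ n * sum (λ v → χ (lookup A v) * lowCount A v)
    codegree-count A = begin
      sum (λ u → sum (λ v → χ (lookup (A ∩ nbhd G u) v) * lowCount (A ∩ nbhd G u) v))
        ≡⟨ sum-cong-≗ (λ u → sum-cong-≗ (link-count A u)) ⟩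
      sum (λ u → sum (λ v → sum (λ w → χ (lowPair A v w ∧ (adj G v u ∧ adj G w u)))))
        ≡⟨ ∑-comm (λ u v → sum (λ w → χ (lowPair A v w ∧ (adj G v u ∧ adj G w u)))) ⟩
      sum (λ v → sum (λ u → sum (λ w → χ (lowPair A v w ∧ (adj G v u ∧ adj G w u)))))
        ≡⟨ sum-cong-≗ (λ v → ∑-comm (λ u w → χ (lowPair A v w ∧ (adj G v u ∧ adj G w u)))) ⟩
      sum (λ v → sum (λ w → sum (λ u → χ (lowPair A v w ∧ (adj G v u ∧ adj G w u)))))
        ≡⟨ sum-cong-≗ (λ v → sum-cong-≗ λ w →
             trans (sym (χ-∧-sum (lowPair A v w) (λ u → adj G v u ∧ adj G w u))) (cong (χ (lowPair A v w) *_) (sym (codeg-sum v w)))) ⟩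
      sum (λ v → sum (λ w → χ (lowPair A v w) * codeg G v w))
        ≤⟨ sum-mono (λ v → sum-mono (lowPair-codeg A v)) ⟩
      sum (λ v → sum (λ w → χ (lowPair A v w) * n))
        ≡⟨ sum-cong-≗ (λ v → trans (sum-over-n v) (cong (n *_) (sym (pairs-count A v)))) ⟩
      sum (λ v → n * (χ (lookup A v) * lowCount A v))
        ≡⟨ sym (*-distribˡ-sum n (λ v → χ (lookup A v) * lowCount A v)) ⟩
      n * sum (λ v → χ (lookup A v) * lowCount A v) ∎
      where
      open ≤-Reasoning
      sum-over-n : ∀ v → sum (λ w → χ (lowPair A v w) * n) ≡ n * sum (λ w → χ (lowPair A v w))
      sum-over-n v = trans (sym (*-distribʳ-sum n (λ w → χ (lowPair A v w)))) (*-comm _ n)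

module Cleaning where

  open import Data.Nat using (ℕ; _+_; _*_; _≤_; _≤?_; z≤n)
  open import Data.Nat.Properties
    using (m≤m+n; ≤-trans; <⇒≤; ≰⇒>; +-identityʳ; *-identityʳ; *-comm; ≤-reflexive; *-zeroʳ; module ≤-Reasoning)
  open import Data.Bool using (Bool; true; false; _∧_)
  open import Data.Fin using (Fin)
  open import Data.Vec using (lookup; tabulate)
  open import Data.Vec.Properties using (lookup∘tabulate; []=⇒lookup; lookup⇒[]=)
  open import Data.Fin.Subset using (Subset; ∣_∣; _⊆_; _∈_)
  open import Function using (_∘_)
  open import Relation.Nullary using (yes; no)
  open import Relation.Nullary.Decidable using (⌊_⌋)
  open import Relation.Binary.PropositionalEquality
  open FiniteCounting

  module _ {N} (S : Subset N) (f : Fin N → ℕ) (K T : ℕ) where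

    clean : Subset N
    clean = tabulate (λ v → lookup S v ∧ ⌊ f v * K ≤? T ⌋)

    lookup-clean : ∀ v → lookup clean v ≡ lookup S v ∧ ⌊ f v * K ≤? T ⌋
    lookup-clean = lookup∘tabulate _

    clean-⊆ : clean ⊆ S
    clean-⊆ {v} v∈ with lookup S v in v∈S | trans (sym (lookup-clean v)) ([]=⇒lookup v∈)
    ... | true  | _ = lookup⇒[]= v S v∈S
    ... | false | ()

    clean-bound : ∀ {v} → v ∈ clean → f v * K ≤ T
    clean-bound {v} v∈ with lookup S v | f v * K ≤? T | trans (sym (lookup-clean v)) ([]=⇒lookup v∈)
    ... | true  | yes small | _  = small
    ... | true  | no  _     | ()
    ... | false | _         | ()

    -- Markov's inequality for the deletion: each discarded vertex has weight
    -- more than T / K, so T times the number of discarded vertices is at most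
    -- K times the total weight of S.
    clean-loss : T * ∣ S ∣ ≤ T * ∣ clean ∣ + K * sum (λ v → χ (lookup S v) * f v)
    clean-loss = subst₂ (λ s c → T * s ≤ T * c + K * sum (λ v → χ (lookup S v) * f v))
      (sym (∣∣-sum S)) (sym (∣∣-by clean kept lookup-clean))
      (sum-affine T K (χ ∘ lookup S) (χ ∘ kept) (λ v → χ (lookup S v) * f v) (λ v → pointwise (lookup S v) (f v)))
      where
      open ≤-Reasoning
      kept : Fin N → Bool
      kept v = lookup S v ∧ ⌊ f v * K ≤? T ⌋
      pointwise : ∀ s b → T * χ s ≤ T * χ (s ∧ ⌊ b * K ≤? T ⌋) + K * (χ s * b)
      pointwise false b = ≤-trans (≤-reflexive (*-zeroʳ T)) z≤n
      pointwise true  b with b * K ≤? T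
      ... | yes _     = m≤m+n (T * 1) (K * (1 * b))
      ... | no  large = begin
        T * 1                ≡⟨ *-identityʳ T ⟩
        T                    ≤⟨ <⇒≤ (≰⇒> large) ⟩
        b * K                ≡⟨ *-comm b K ⟩
        K * b                ≡⟨ cong (K *_) (sym (+-identityʳ b)) ⟩
        K * (1 * b)          ≡⟨ cong (_+ K * (1 * b)) (sym (*-zeroʳ T)) ⟩
        T * 0 + K * (1 * b)  ∎

module Arithmetic where

  open import Data.Nat
  open import Data.Nat.Properties
  open import Data.Nat.Tactic.RingSolver using (solve)
  open import Data.List using (_∷_; [])
  open ≤-Reasoning

  -- The cleaning loss at level i, with the level-dependent factors P = p ^ i
  -- and E = D ^ i cancelled: the vertices discarded from all the sets
  -- S_u number at most D² n a / (2 p²) in total.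
  cancelled-loss : ∀ p D n a P E S R Y Z .{{_ : NonZero a}} .{{_ : NonZero P}} →
    2 * (p * (p * P)) * a * S ≤ 2 * (p * (p * P)) * a * R + D * (D * E) * Y →
    Y ≤ n * Z →
    Z * E ≤ a * (P * a) →
    2 * (p * p) * S ≤ 2 * (p * p) * R + D * D * n * a
  cancelled-loss p D n a P E S R Y Z loss Y≤nZ ZE≤aPa = *-cancelˡ-≤ (P * a) (begin
    P * a * (2 * (p * p) * S)                                  ≡⟨ solve (p ∷ a ∷ P ∷ S ∷ []) ⟩
    2 * (p * (p * P)) * a * S                                  ≤⟨ loss ⟩
    2 * (p * (p * P)) * a * R + D * (D * E) * Y                ≤⟨ +-monoʳ-≤ (2 * (p * (p * P)) * a * R) (*-monoʳ-≤ (D * (D * E)) Y≤nZ) ⟩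
    2 * (p * (p * P)) * a * R + D * (D * E) * (n * Z)          ≡⟨ solve (p ∷ P ∷ a ∷ R ∷ D ∷ E ∷ n ∷ Z ∷ []) ⟩
    2 * (p * (p * P)) * a * R + D * D * n * (Z * E)            ≤⟨ +-monoʳ-≤ (2 * (p * (p * P)) * a * R) (*-monoʳ-≤ (D * D * n) ZE≤aPa) ⟩
    2 * (p * (p * P)) * a * R + D * D * n * (a * (P * a))      ≡⟨ solve (p ∷ P ∷ a ∷ R ∷ D ∷ n ∷ []) ⟩
    P * a * (2 * (p * p) * R + D * D * n * a)                  ∎)
    where instance _ = m*n≢0 P a

  -- With the degree lower bound a p N ≤ 2 q S and 128 n q³ ≤ p³ N, the
  -- kept vertices number at least 2 p a N / (8 q) in total, so the best of
  -- N candidates (R ≤ N b) has at least 2 p a / (8 q) vertices.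
  growth : ∀ p q n N a b S R .{{_ : NonZero p}} .{{_ : NonZero N}} →
    2 * (p * p) * S ≤ 2 * (p * p) * R + 8 * q * (8 * q) * n * a →
    a * (p * N) ≤ 2 * q * S →
    128 * n * (q * q * q) ≤ p * p * p * N →
    R ≤ N * b →
    2 * p * a ≤ 8 * q * b
  growth p q n N a b S R loss degrees density average = *-cancelʳ-≤ _ _ N (begin
    2 * p * a * N   ≤⟨ *-cancelˡ-≤ (p * p) (+-cancelʳ-≤ _ _ _ summed) ⟩
    8 * q * R       ≤⟨ *-monoʳ-≤ (8 * q) average ⟩
    8 * q * (N * b) ≡⟨ solve (q ∷ N ∷ b ∷ []) ⟩
    8 * q * b * N   ∎)
    where
    instance _ = m*n≢0 p p
    summed : p * p * (2 * p * a * N) + p * p * (2 * p * a * N) ≤ p * p * (8 * q * R) + p * p * (2 * p * a * N)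
    summed = begin
      p * p * (2 * p * a * N) + p * p * (2 * p * a * N)        ≡⟨ solve (p ∷ a ∷ N ∷ []) ⟩
      4 * (p * p) * (a * (p * N))                             ≤⟨ *-monoʳ-≤ (4 * (p * p)) degrees ⟩
      4 * (p * p) * (2 * q * S)                               ≡⟨ solve (p ∷ q ∷ S ∷ []) ⟩
      4 * q * (2 * (p * p) * S)                               ≤⟨ *-monoʳ-≤ (4 * q) loss ⟩
      4 * q * (2 * (p * p) * R + 8 * q * (8 * q) * n * a)     ≡⟨ solve (p ∷ q ∷ R ∷ n ∷ a ∷ []) ⟩
      p * p * (8 * q * R) + 2 * a * (128 * n * (q * q * q))   ≤⟨ +-monoʳ-≤ (p * p * (8 * q * R)) (*-monoʳ-≤ (2 * a) density) ⟩
      p * p * (8 * q * R) + 2 * a * (p * p * p * N)           ≡⟨ solve (p ∷ q ∷ R ∷ a ∷ N ∷ []) ⟩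
      p * p * (8 * q * R) + p * p * (2 * p * a * N)           ∎

  -- Propagation of the codegree condition from level i to level i + 1: a
  -- kept vertex had at most 2 p^(i+2) a / D^(i+2) low partners (b ≤ that),
  -- and the new set has size a' ≥ 2 p a / D.
  next-level : ∀ D p P E a a' b b' .{{_ : NonZero D}} →
    b' ≤ b →
    b * (D * (D * E)) ≤ 2 * (p * (p * P)) * a →
    2 * p * a ≤ D * a' →
    b' * (D * E) ≤ p * P * a'
  next-level D p P E a a' b b' b'≤b kept grows = *-cancelˡ-≤ D (begin
    D * (b' * (D * E))       ≤⟨ *-monoʳ-≤ D (*-monoˡ-≤ (D * E) b'≤b) ⟩
    D * (b * (D * E))        ≡⟨ solve (D ∷ b ∷ E ∷ []) ⟩
    b * (D * (D * E))        ≤⟨ kept ⟩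
    2 * (p * (p * P)) * a    ≡⟨ solve (p ∷ P ∷ a ∷ []) ⟩
    p * P * (2 * p * a)      ≤⟨ *-monoʳ-≤ (p * P) grows ⟩
    p * P * (D * a')         ≡⟨ solve (p ∷ P ∷ D ∷ a' ∷ []) ⟩
    D * (p * P * a')         ∎)

module Refinement where

  open import Defs using (Graph; nbhd; degree)
  open import Data.Nat
  open import Data.Nat.Properties
  open import Data.Bool using (true; false)
  open import Data.Fin using (Fin)
  open import Data.Vec using (lookup)
  open import Data.Vec.Properties using (lookup⇒[]=)
  open import Data.Fin.Subset using (Subset; ∣_∣; _∩_; _⊆_; _∈_)
  open import Data.Fin.Subset.Properties using (⊆-trans; p∩q⊆p)
  open import Data.Product using (proj₁; proj₂)
  open import Relation.Binary.PropositionalEquality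
  open import Relation.Nullary using (yes; no)
  open FiniteCounting
  open GraphCounting
  open Cleaning
  open Arithmetic

  -- Throughout, ε = p / q and the density hypothesis N ≥ 128 ε⁻³ n is
  -- cleared of denominators; D = 8 q, so that ε / 8 = p / D.
  module Step {M} (G : Graph (suc M)) (n p q : ℕ) .{{_ : NonZero p}} .{{_ : NonZero q}}
           (density : 128 * n * (q * q * q) ≤ p * p * p * suc M) where

    D : ℕ
    D = 8 * q

    HighDegree : Subset (suc M) → Set
    HighDegree A = ∀ {v} → v ∈ A → p * suc M ≤ 2 * q * degree G v

    Sparse : ℕ → Subset (suc M) → Set
    Sparse i A = ∀ {v} → v ∈ A → lowCount G n A v * D ^ i ≤ p ^ i * ∣ A ∣

    sparse-weight : ∀ {i A} → Sparse i A →
      sum (λ v → χ (lookup A v) * lowCount G n A v) * D ^ i ≤ ∣ A ∣ * (p ^ i * ∣ A ∣)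
    sparse-weight {i} {A} sparse = begin
      sum (λ v → χ (lookup A v) * lowCount G n A v) * D ^ i  ≡⟨ *-distribʳ-sum (D ^ i) (λ v → χ (lookup A v) * lowCount G n A v) ⟩
      sum (λ v → χ (lookup A v) * lowCount G n A v * D ^ i)  ≤⟨ sum-mono pointwise ⟩
      sum (λ v → χ (lookup A v) * (p ^ i * ∣ A ∣))          ≡⟨ sum-over-const A (p ^ i * ∣ A ∣) ⟩
      ∣ A ∣ * (p ^ i * ∣ A ∣)                                ∎
      where
      open ≤-Reasoning
      pointwise : ∀ v → χ (lookup A v) * lowCount G n A v * D ^ i ≤ χ (lookup A v) * (p ^ i * ∣ A ∣)
      pointwise v with lookup A v in v∈A
      ... | false = z≤n
      ... | true  = subst₂ _≤_ (cong (_* D ^ i) (sym (+-identityʳ (lowCount G n A v)))) (sym (+-identityʳ (p ^ i * ∣ A ∣)))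
                           (sparse (lookup⇒[]= v A v∈A))

    link-total : ∀ {A} → HighDegree A → ∣ A ∣ * (p * suc M) ≤ 2 * q * sum (λ u → ∣ A ∩ nbhd G u ∣)
    link-total {A} high = begin
      ∣ A ∣ * (p * suc M)                                  ≡⟨ sym (sum-over-const A (p * suc M)) ⟩
      sum (λ v → χ (lookup A v) * (p * suc M))            ≤⟨ sum-mono pointwise ⟩
      sum (λ v → 2 * q * (χ (lookup A v) * degree G v))   ≡⟨ sym (*-distribˡ-sum (2 * q) (λ v → χ (lookup A v) * degree G v)) ⟩
      2 * q * sum (λ v → χ (lookup A v) * degree G v)     ≡⟨ cong (2 * q *_) (sym (handshake G n A)) ⟩
      2 * q * sum (λ u → ∣ A ∩ nbhd G u ∣)                ∎
      where
      open ≤-Reasoning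
      pointwise : ∀ v → χ (lookup A v) * (p * suc M) ≤ 2 * q * (χ (lookup A v) * degree G v)
      pointwise v with lookup A v in v∈A
      ... | false = z≤n
      ... | true  = subst₂ _≤_ (sym (+-identityʳ (p * suc M))) (cong (2 * q *_) (sym (+-identityʳ (degree G v))))
                           (high (lookup⇒[]= v A v∈A))

    module _ (i : ℕ) (A : Subset (suc M)) where

      link : Fin (suc M) → Subset (suc M)
      link u = A ∩ nbhd G u

      K T : ℕ
      K = D ^ (2 + i)
      T = 2 * p ^ (2 + i) * ∣ A ∣

      candidate : Fin (suc M) → Subset (suc M)
      candidate u = clean (link u) (lowCount G n (link u)) K T

      chosen : Fin (suc M)
      chosen = proj₁ (above-average (λ u → ∣ candidate u ∣))

      refine : Subset (suc M)
      refine = candidate chosen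

      refine-⊆ : refine ⊆ A
      refine-⊆ = ⊆-trans (clean-⊆ (link chosen) (lowCount G n (link chosen)) K T) (p∩q⊆p A (nbhd G chosen))

      total-loss : T * sum (λ u → ∣ link u ∣) ≤ T * sum (λ u → ∣ candidate u ∣)
        + K * sum (λ u → sum (λ v → χ (lookup (link u) v) * lowCount G n (link u) v))
      total-loss = sum-affine T K (λ u → ∣ link u ∣) (λ u → ∣ candidate u ∣)
        (λ u → sum (λ v → χ (lookup (link u) v) * lowCount G n (link u) v)) (λ u → clean-loss (link u) (lowCount G n (link u)) K T)

      -- The refined set keeps a fraction 2 p / D = ε / 4 of A; the empty set
      -- is trivial, otherwise combine the loss bound with the averaging choice.
      refine-grows : HighDegree A → Sparse i A → 2 * p * ∣ A ∣ ≤ D * ∣ refine ∣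
      refine-grows high sparse with ∣ A ∣ ≟ 0
      ... | yes empty = subst (λ a → 2 * p * a ≤ D * ∣ refine ∣) (sym empty)
                          (≤-trans (≤-reflexive (*-zeroʳ (2 * p))) z≤n)
      ... | no nonempty = growth p q n (suc M) ∣ A ∣ ∣ refine ∣ _ _ loss (link-total high) density
                            (proj₂ (above-average (λ u → ∣ candidate u ∣)))
        where
        instance _ = ≢-nonZero nonempty
        instance _ = m^n≢0 p i
        loss : 2 * (p * p) * sum (λ u → ∣ link u ∣)
             ≤ 2 * (p * p) * sum (λ u → ∣ candidate u ∣) + D * D * n * ∣ A ∣
        loss = cancelled-loss p D n ∣ A ∣ (p ^ i) (D ^ i) _ _ _ _
                 total-loss (codegree-count G n A) (sparse-weight {i} sparse)

      refine-sparse : HighDegree A → Sparse i A → Sparse (suc i) refine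
      refine-sparse high sparse {v} v∈ =
        next-level D p (p ^ i) (D ^ i) ∣ A ∣ ∣ refine ∣ _ _
          (lowCount-mono G n v (clean-⊆ (link chosen) (lowCount G n (link chosen)) K T))
          (clean-bound (link chosen) (lowCount G n (link chosen)) K T v∈)
          (refine-grows high sparse)
        where instance _ = m*n≢0 8 q

module Construction where

  open import Defs using (Graph; degree)
  open import Data.Nat
  open import Data.Nat.Properties
  open import Data.Fin.Subset using (Subset; ∣_∣; _⊆_; _∈_)
  open import Data.Fin.Subset.Properties using (⊆-refl; ∣p∩q∣≤∣p∣)
  open import Data.Vec using ([])
  open import Data.Product using (Σ; _×_; _,_; proj₁; proj₂)
  open import Relation.Binary.PropositionalEquality
  open GraphCounting using (lowCount)

  NestedSequence : ∀ {N} → Graph N → (n p q : ℕ) → Subset N → Set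
  NestedSequence {N} G n p q V = Σ (ℕ → Subset N) λ A → A 0 ≡ V × ∀ i →
    A (suc i) ⊆ A i ×
    2 * p * ∣ A i ∣ ≤ 8 * q * ∣ A (suc i) ∣ ×
    (∀ {v} → v ∈ A i → lowCount G n (A i) v * (8 * q) ^ i ≤ p ^ i * ∣ A i ∣)

  nested-sequence : ∀ {N} (G : Graph N) (n p q : ℕ) .{{_ : NonZero p}} .{{_ : NonZero q}} →
    128 * n * (q * q * q) ≤ p * p * p * N →
    (V : Subset N) → (∀ {v} → v ∈ V → p * N ≤ 2 * q * degree G v) →
    NestedSequence G n p q V
  nested-sequence {zero} G n p q _ [] _ =
    (λ _ → []) , refl , λ i → ⊆-refl , ≤-reflexive (trans (*-zeroʳ (2 * p)) (sym (*-zeroʳ (8 * q)))) , λ { {()} }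
  nested-sequence {suc M} G n p q density V high =
    A , refl , λ i → refine-⊆ i (A i) , refine-grows i (A i) (invariant i .proj₁) (invariant i .proj₂)
                   , invariant i .proj₂
    where
    open Refinement.Step G n p q density
    A : ℕ → Subset (suc M)
    A zero    = V
    A (suc i) = refine i (A i)

    invariant : ∀ i → HighDegree (A i) × Sparse i (A i)
    invariant zero    = high , λ {v} _ → subst₂ _≤_ (sym (*-identityʳ (lowCount G n V v))) (sym (+-identityʳ ∣ V ∣))
                                            (∣p∩q∣≤∣p∣ V _)
    invariant (suc i) = let high-i , sparse-i = invariant i in
      (λ v∈ → high-i (refine-⊆ i (A i) v∈)) , refine-sparse i (A i) high-i sparse-i

module Fractions where

  open import Defs using (ℕ→ℚ; _^ℚ_)
  open import Data.Nat as ℕ using (ℕ; zero; suc)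
  open import Data.Integer as ℤ using (+_)
  import Data.Integer.Properties as ℤ
  open import Data.Rational using (ℚ; _/_; _*_; _≤_; toℚᵘ)
  import Data.Rational.Properties as ℚ
  import Data.Rational.Unnormalised as ℚᵘ
  import Data.Rational.Unnormalised.Properties as ℚᵘ
  open import Function using (_$_)
  open import Relation.Binary.PropositionalEquality

  data IsFraction (X : ℚ) (a : ℕ) : ℕ → Set where
    fraction : ∀ d → toℚᵘ X ℚᵘ.≃ ℚᵘ.mkℚᵘ (+ a) d → IsFraction X a (suc d)

  fraction-/ : ∀ a d → IsFraction (+ a / suc d) a (suc d)
  fraction-/ a d = fraction d (ℚ.toℚᵘ-fromℚᵘ (ℚᵘ.mkℚᵘ (+ a) d))

  fraction-ℕ : ∀ a → IsFraction (ℕ→ℚ a) a 1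
  fraction-ℕ a = fraction-/ a 0

  fraction-* : ∀ {X Y a b D E} → IsFraction X a D → IsFraction Y b E → IsFraction (X * Y) (a ℕ.* b) (D ℕ.* E)
  fraction-* {X} {Y} {a} {b} (fraction d X≃) (fraction e Y≃) =
    fraction (e ℕ.+ d ℕ.* suc e) $
    ℚᵘ.≃-trans (ℚ.toℚᵘ-homo-* X Y)
      (ℚᵘ.≃-trans (ℚᵘ.*-cong X≃ Y≃) (ℚᵘ.*≡* (cong (ℤ._* + suc (e ℕ.+ d ℕ.* suc e)) (sym (ℤ.pos-* a b)))))

  fraction-^ : ∀ {X a D} → IsFraction X a D → ∀ i → IsFraction (X ^ℚ i) (a ℕ.^ i) (D ℕ.^ i)
  fraction-^ X≡ zero    = fraction 0 ℚᵘ.≃-refl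
  fraction-^ X≡ (suc i) = fraction-* X≡ (fraction-^ X≡ i)

  fraction-≤ : ∀ {X Y a b D E} → IsFraction X a D → IsFraction Y b E → a ℕ.* E ℕ.≤ b ℕ.* D → X ≤ Y
  fraction-≤ {a = a} {b} (fraction d X≃) (fraction e Y≃) aE≤bD =
    ℚ.toℚᵘ-cancel-≤ (ℚᵘ.≤-respˡ-≃ (ℚᵘ.≃-sym X≃) (ℚᵘ.≤-respʳ-≃ (ℚᵘ.≃-sym Y≃)
      (ℚᵘ.*≤* (subst₂ ℤ._≤_ (ℤ.pos-* a (suc e)) (ℤ.pos-* b (suc d)) (ℤ.+≤+ aE≤bD)))))

  fraction-≤⁻ : ∀ {X Y a b D E} → IsFraction X a D → IsFraction Y b E → X ≤ Y → a ℕ.* E ℕ.≤ b ℕ.* D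
  fraction-≤⁻ {a = a} {b} (fraction d X≃) (fraction e Y≃) X≤Y
    with ℚᵘ.≤-respˡ-≃ X≃ (ℚᵘ.≤-respʳ-≃ Y≃ (ℚ.toℚᵘ-mono-≤ X≤Y))
  ... | ℚᵘ.*≤* aE≤bD = ℤ.drop‿+≤+ (subst₂ ℤ._≤_ (sym (ℤ.pos-* a (suc e))) (sym (ℤ.pos-* b (suc d))) aE≤bD)

module Scaling where

  open import Defs using (Graph; ℕ→ℚ; _^ℚ_; degree; highDeg)
  open import Data.Nat as ℕ using (ℕ)
  open import Data.Nat.Properties as ℕ using ()
  open import Data.Nat.Tactic.RingSolver using (solve)
  open import Data.List using (_∷_; [])
  open import Data.Fin.Subset using (_∈_)
  open import Data.Bool using (T)
  open import Data.Unit using (tt)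
  open import Data.Vec.Properties using (lookup∘tabulate; []=⇒lookup)
  open import Data.Integer using (+_)
  open import Data.Rational using (ℚ; _/_; _*_; _≤_)
  open import Relation.Nullary.Decidable using (toWitness)
  open import Relation.Binary.PropositionalEquality
  open Fractions

  module _ {ε p q} (ε≡p/q : IsFraction ε p q) where

    ε/8≡p/8q : IsFraction (ε * (+ 1 / 8)) (p ℕ.* 1) (q ℕ.* 8)
    ε/8≡p/8q = fraction-* ε≡p/q (fraction-/ 1 7)

    density→ℕ : ∀ n N → ℕ→ℚ 128 * ℕ→ℚ n ≤ (ε ^ℚ 3) * ℕ→ℚ N →
                128 ℕ.* n ℕ.* (q ℕ.* q ℕ.* q) ℕ.≤ p ℕ.* p ℕ.* p ℕ.* N
    density→ℕ n N density = begin
      128 ℕ.* n ℕ.* (q ℕ.* q ℕ.* q)      ≡⟨ solve (n ∷ q ∷ []) ⟩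
      128 ℕ.* n ℕ.* (q ℕ.* (q ℕ.* (q ℕ.* 1)) ℕ.* 1)  ≤⟨ fraction-≤⁻ (fraction-* (fraction-ℕ 128) (fraction-ℕ n))
                                                        (fraction-* (fraction-^ ε≡p/q 3) (fraction-ℕ N)) density ⟩
      p ℕ.* (p ℕ.* (p ℕ.* 1)) ℕ.* N ℕ.* (1 ℕ.* 1)    ≡⟨ solve (p ∷ N ∷ []) ⟩
      p ℕ.* p ℕ.* p ℕ.* N                ∎
      where open ℕ.≤-Reasoning

    highDeg→ℕ : ∀ {N} (G : Graph N) {v} → v ∈ highDeg G ε → p ℕ.* N ℕ.≤ 2 ℕ.* q ℕ.* degree G v
    highDeg→ℕ {N} G {v} v∈ = begin
      p ℕ.* N                         ≡⟨ solve (p ∷ N ∷ []) ⟩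
      p ℕ.* N ℕ.* 1 ℕ.* 1             ≤⟨ fraction-≤⁻ (fraction-* (fraction-* ε≡p/q (fraction-ℕ N)) (fraction-/ 1 1))
                                                     (fraction-ℕ (degree G v)) high ⟩
      degree G v ℕ.* (q ℕ.* 1 ℕ.* 2)  ≡⟨ rearrange (degree G v) ⟩
      2 ℕ.* q ℕ.* degree G v          ∎
      where
      open ℕ.≤-Reasoning
      rearrange : ∀ d → d ℕ.* (q ℕ.* 1 ℕ.* 2) ≡ 2 ℕ.* q ℕ.* d
      rearrange d = solve (d ∷ q ∷ [])
      high : (ε * ℕ→ℚ N) * (+ 1 / 2) ≤ ℕ→ℚ (degree G v)
      high = toWitness (subst T (trans (sym ([]=⇒lookup v∈)) (lookup∘tabulate _ v)) tt)

    growth→ℚ : ∀ a b → 2 ℕ.* p ℕ.* a ℕ.≤ 8 ℕ.* q ℕ.* b → (ε * (+ 1 / 8)) * ℕ→ℚ a ≤ ℕ→ℚ b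
    growth→ℚ a b grows = fraction-≤ (fraction-* ε/8≡p/8q (fraction-ℕ a)) (fraction-ℕ b) (begin
      p ℕ.* 1 ℕ.* a ℕ.* 1    ≡⟨ solve (p ∷ a ∷ []) ⟩
      p ℕ.* a                ≤⟨ ℕ.m≤n*m (p ℕ.* a) 2 ⟩
      2 ℕ.* (p ℕ.* a)        ≡⟨ ℕ.*-assoc 2 p a ⟨
      2 ℕ.* p ℕ.* a          ≤⟨ grows ⟩
      8 ℕ.* q ℕ.* b          ≡⟨ solve (q ∷ b ∷ []) ⟩
      b ℕ.* (q ℕ.* 8 ℕ.* 1)  ∎)
      where open ℕ.≤-Reasoning

    sparse→ℚ : ∀ i b a → b ℕ.* (8 ℕ.* q) ℕ.^ i ℕ.≤ p ℕ.^ i ℕ.* a →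
               ℕ→ℚ b ≤ ((ε * (+ 1 / 8)) ^ℚ i) * ℕ→ℚ a
    sparse→ℚ i b a sparse = fraction-≤ (fraction-ℕ b) (fraction-* (fraction-^ ε/8≡p/8q i) (fraction-ℕ a)) (begin
      b ℕ.* ((q ℕ.* 8) ℕ.^ i ℕ.* 1)  ≡⟨ cong (b ℕ.*_) (trans (ℕ.*-identityʳ _) (cong (ℕ._^ i) (ℕ.*-comm q 8))) ⟩
      b ℕ.* (8 ℕ.* q) ℕ.^ i         ≤⟨ sparse ⟩
      p ℕ.^ i ℕ.* a                 ≡⟨ sym (trans (ℕ.*-identityʳ _) (cong (λ x → x ℕ.^ i ℕ.* a) (ℕ.*-identityʳ p))) ⟩
      (p ℕ.* 1) ℕ.^ i ℕ.* a ℕ.* 1  ∎)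
      where open ℕ.≤-Reasoning

open import Defs
open import Data.Nat using (ℕ; zero; suc; _≥_)
open import Data.Fin using (Fin)
open import Data.Fin.Subset using (Subset; _∈_; _⊆_; ∣_∣)
open import Data.Integer using (+_; +[1+_]; -[1+_])
open import Data.Rational using (ℚ; mkℚ; positive; _/_; _*_; _≤_; _<_; 0ℚ)
open import Data.Rational.Unnormalised.Properties using (≃-refl)
open import Data.Product using (Σ; _×_; _,_)
open import Relation.Binary.PropositionalEquality using (_≡_)
open Construction using (nested-sequence)
open Fractions using (IsFraction; fraction)
open Scaling

lemma8p4 : (ε : ℚ) → 0ℚ < ε → (n : ℕ) → n ≥ 1 → (N : ℕ) → (G : Graph N) →
    ℕ→ℚ 128 * ℕ→ℚ n ≤ (ε ^ℚ 3) * ℕ→ℚ N →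
    Σ (ℕ → Subset N) (λ A →
    (A 0 ≡ highDeg G ε) ×
    ((i : ℕ) →
    (A (suc i) ⊆ A i) ×
    ((ε * (+ 1 / 8)) * ℕ→ℚ ∣ A i ∣ ≤ ℕ→ℚ ∣ A (suc i) ∣) ×
    ((v : Fin N) → v ∈ A i →
    ℕ→ℚ ∣ lowCodeg G n (A i) v ∣ ≤ ((ε * (+ 1 / 8)) ^ℚ i) * ℕ→ℚ ∣ A i ∣)))
lemma8p4 (mkℚ (+ zero)   _ _) 0<ε _ _ _ _ _ with positive 0<ε
... | ()
lemma8p4 (mkℚ -[1+ _ ]   _ _) 0<ε _ _ _ _ _ with positive 0<ε
... | ()
lemma8p4 ε@(mkℚ +[1+ p′ ] q′ _) _ n _ N G density =
  let A , A₀≡V , steps = nested-sequence G n p q (density→ℕ ε≡p/q n N density)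
                           (highDeg G ε) (highDeg→ℕ ε≡p/q G)
  in A , A₀≡V , λ i → let ⊆ , grows , sparse = steps i in
       ⊆ , growth→ℚ ε≡p/q ∣ A i ∣ ∣ A (suc i) ∣ grows ,
       λ v v∈ → sparse→ℚ ε≡p/q i ∣ lowCodeg G n (A i) v ∣ ∣ A i ∣ (sparse v∈)
  where
  p q : ℕ
  p = suc p′
  q = suc q′
  -- ε is stored in lowest terms as p / q.
  ε≡p/q : IsFraction ε p q
  ε≡p/q = fraction q′ ≃-refl
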